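{- For every positive integer $n$ and every $n\times n$ magog matrix $A$, $\mathrm{inv}(A)\le\binom{n}{2}$.
   Context: An $n\times n$ magog matrix is an $n\times n$ matrix $A=(a_{ij})$ with entries in $\{0,1,-1\}$ such that all row sums and all column sums equal $1$, $0\le \sum_{i'=1}^{i}a_{i'j}\le 1$ for all $1\le i,j\le n$, $\sum_{j'=1}^{j}a_{ij'}\ge 0$ for all $1\le i,j\le n$, and for all $1\le i\le n-2$, $1\le j\le n-2$, $$\sum_{j'=1}^{j}a_{i+1,j'}+\sum_{i'=1}^{i+1}a_{i',j+1}-\sum_{i'=1}^{i}a_{i'j}\ge 0.$$ The inversion number of $A$ is $\mathrm{inv}(A)=\sum_{1\le k<i\le n}\sum_{1\le j<l\le n}a_{ij}a_{kl}$. -}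

module Defs where

open import Data.Nat as ℕ using (ℕ; suc; _≤ᵇ_; _<ᵇ_)
open import Data.Integer using (ℤ; 0ℤ; 1ℤ; -1ℤ; _+_; _-_; _*_; _≤_)
open import Data.Fin using (Fin; toℕ)
open import Data.Vec.Functional using (Vector)
open import Data.Bool using (if_then_else_)
open import Data.Product using (_×_)
open import Data.Sum using (_⊎_)
open import Relation.Binary.PropositionalEquality using (_≡_)

Matrix : ℕ → Set
Matrix n = Fin n → Fin n → ℤ

Σ : ∀ {n} → (Fin n → ℤ) → ℤ
Σ {ℕ.zero} f = 0ℤ
Σ {suc n} f = f Fin.zero + Σ (λ k → f (Fin.suc k))
  where import Data.Fin as Fin

Σ≤ : ∀ {n} → Fin n → (Fin n → ℤ) → ℤ
Σ≤ j f = Σ (λ k → if toℕ k ≤ᵇ toℕ j then f k else 0ℤ)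

Σ< : ∀ {n} → Fin n → (Fin n → ℤ) → ℤ
Σ< j f = Σ (λ k → if toℕ k <ᵇ toℕ j then f k else 0ℤ)

IsSignEntry : ℤ → Set
IsSignEntry x = x ≡ 0ℤ ⊎ x ≡ 1ℤ ⊎ x ≡ -1ℤ

-- Magog matrix (paper's 1-based indices i,j correspond to 0-based Fin values).
record IsMagog {n : ℕ} (A : Matrix n) : Set where
  field
    entries   : ∀ i j → IsSignEntry (A i j)
    rowSum    : ∀ i → Σ (λ j → A i j) ≡ 1ℤ
    colSum    : ∀ j → Σ (λ i → A i j) ≡ 1ℤ
    colPrefLo : ∀ i j → 0ℤ ≤ Σ≤ i (λ i' → A i' j)
    colPrefHi : ∀ i j → Σ≤ i (λ i' → A i' j) ≤ 1ℤ
    rowPref   : ∀ i j → 0ℤ ≤ Σ≤ j (λ j' → A i j')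
    -- 1-based i, j ∈ [1, n-2]: writing i₀ = i-1, j₀ = j-1 (0-based),
    -- i+1 (1-based) is the 0-based index i₀+1 =: i₁, similarly j₁.
    -- Condition: Σ_{j' ≤ j} a_{i+1,j'} + Σ_{i' ≤ i+1} a_{i',j+1} - Σ_{i' ≤ i} a_{i',j} ≥ 0.
    -- We quantify over 0-based i₀, i₁, j₀, j₁ with i₁ = i₀+1, j₁ = j₀+1
    -- and i₀+2 < n and j₀+2 < n (i.e. 1-based i ≤ n-2, j ≤ n-2).
    special   : ∀ (i₀ i₁ j₀ j₁ : Fin n) →
                toℕ i₁ ≡ suc (toℕ i₀) → toℕ j₁ ≡ suc (toℕ j₀) →
                suc (suc (toℕ i₀)) ℕ.< n → suc (suc (toℕ j₀)) ℕ.< n →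
                0ℤ ≤ (Σ≤ j₀ (λ j' → A i₁ j') + Σ≤ i₁ (λ i' → A i' j₁))
                       - Σ≤ i₀ (λ i' → A i' j₀)

inv : ∀ {n} → Matrix n → ℤ
inv A = Σ (λ i → Σ (λ j → A i j * Σ< i (λ k → Σ (λ l →
          if toℕ j <ᵇ toℕ l then A k l else 0ℤ))))

{-# OPTIONS --safe #-}
-- Weighting every entry a_ij by the number i of rows above it gives Σ_i i = C(n,2),
-- because all row sums are 1.  Splitting those rows at column j writes C(n,2) as
-- inv(A) + Σ_ij a_ij Σ_{k<i} Σ_{l≤j} a_kl.  Exchanging summations and using that all
-- column sums are 1, the second term is Σ_ij (1 - c_ij) r_ij, where c and r are the
-- column and row prefix sums; it is nonnegative because c_ij ≤ 1 and r_ij ≥ 0.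
module Submission where

open import Defs
open import Data.Nat using (ℕ; suc) renaming (_≤_ to _≤ℕ_)
open import Data.Nat.Combinatorics using (_C_)
open import Data.Integer using (_≤_; +_)

open import Algebra.Bundles using (AbelianGroup)
open import Algebra.Properties.Group using (//-rightDividesʳ)
open import Data.Bool using (Bool; true; false; not; if_then_else_)
open import Data.Fin using (Fin; toℕ) renaming (zero to fzero; suc to fsuc)
open import Data.Integer using (ℤ; 0ℤ; 1ℤ; _+_; _-_; _*_; +≤+; nonNegative)
open import Data.Integer.Properties as ℤ using (+-*-semiring; +-0-abelianGroup)
open import Data.Nat as ℕ using (zero; _<ᵇ_; _≤ᵇ_)
open import Data.Nat.Combinatorics using (nC1≡n; nCk+nC[k+1]≡[n+1]C[k+1])
open import Relation.Binary.PropositionalEquality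
open import Algebra.Properties.Semiring.Sum +-*-semiring
  using (sum; sum-cong-≗; sum-replicate-zero; ∑-distrib-+; ∑-comm; *-distribˡ-sum; *-distribʳ-sum)
open ≡-Reasoning

Σ≡sum : ∀ {n} (f : Fin n → ℤ) → Σ f ≡ sum f
Σ≡sum {zero}  f = refl
Σ≡sum {suc n} f = cong (_+_ (f fzero)) (Σ≡sum (λ i → f (fsuc i)))

Σ-cong : ∀ {n} {f g : Fin n → ℤ} → (∀ i → f i ≡ g i) → Σ f ≡ Σ g
Σ-cong {f = f} {g} f≗g = trans (Σ≡sum f) (trans (sum-cong-≗ f≗g) (sym (Σ≡sum g)))

Σ-zero : ∀ n → Σ {n} (λ _ → 0ℤ) ≡ 0ℤ
Σ-zero n = trans (Σ≡sum {n} (λ _ → 0ℤ)) (sum-replicate-zero n)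

Σ-one : ∀ n → Σ {n} (λ _ → 1ℤ) ≡ + n
Σ-one zero    = refl
Σ-one (suc n) = cong (_+_ 1ℤ) (Σ-one n)

Σ-distrib-+ : ∀ {n} (f g : Fin n → ℤ) → Σ (λ i → f i + g i) ≡ Σ f + Σ g
Σ-distrib-+ f g = begin
  Σ (λ i → f i + g i)    ≡⟨ Σ≡sum (λ i → f i + g i) ⟩
  sum (λ i → f i + g i)  ≡⟨ ∑-distrib-+ f g ⟩
  sum f + sum g          ≡⟨ cong₂ _+_ (Σ≡sum f) (Σ≡sum g) ⟨
  Σ f + Σ g              ∎

*-distribˡ-Σ : ∀ {n} x (f : Fin n → ℤ) → x * Σ f ≡ Σ (λ i → x * f i)
*-distribˡ-Σ x f =
  trans (cong (x *_) (Σ≡sum f)) (trans (*-distribˡ-sum x f) (sym (Σ≡sum (λ i → x * f i))))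

*-distribʳ-Σ : ∀ {n} x (f : Fin n → ℤ) → Σ f * x ≡ Σ (λ i → f i * x)
*-distribʳ-Σ x f =
  trans (cong (_* x) (Σ≡sum f)) (trans (*-distribʳ-sum x f) (sym (Σ≡sum (λ i → f i * x))))

Σ-comm : ∀ {m n} (f : Fin m → Fin n → ℤ) →
         Σ (λ i → Σ (λ j → f i j)) ≡ Σ (λ j → Σ (λ i → f i j))
Σ-comm f = begin
  Σ (λ i → Σ (λ j → f i j))      ≡⟨ Σ-cong (λ i → Σ≡sum (f i)) ⟩
  Σ (λ i → sum (λ j → f i j))    ≡⟨ Σ≡sum (λ i → sum (λ j → f i j)) ⟩
  sum (λ i → sum (λ j → f i j))  ≡⟨ ∑-comm f ⟩
  sum (λ j → sum (λ i → f i j))  ≡⟨ Σ≡sum (λ j → sum (λ i → f i j)) ⟨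
  Σ (λ j → sum (λ i → f i j))    ≡⟨ Σ-cong (λ j → Σ≡sum (λ i → f i j)) ⟨
  Σ (λ j → Σ (λ i → f i j))      ∎

Σ-nonneg : ∀ {n} (f : Fin n → ℤ) → (∀ i → 0ℤ ≤ f i) → 0ℤ ≤ Σ f
Σ-nonneg {zero}  f 0≤f = +≤+ ℕ.z≤n
Σ-nonneg {suc n} f 0≤f =
  ℤ.+-mono-≤ (0≤f fzero) (Σ-nonneg (λ i → f (fsuc i)) (λ i → 0≤f (fsuc i)))

Σ-toℕ≡nC2 : ∀ n → Σ {n} (λ i → + toℕ i) ≡ + (n C 2)
Σ-toℕ≡nC2 zero    = refl
Σ-toℕ≡nC2 (suc n) = begin
  0ℤ + Σ {n} (λ i → 1ℤ + + toℕ i)         ≡⟨ ℤ.+-identityˡ _ ⟩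
  Σ {n} (λ i → 1ℤ + + toℕ i)              ≡⟨ Σ-distrib-+ {n} (λ _ → 1ℤ) (λ i → + toℕ i) ⟩
  Σ {n} (λ _ → 1ℤ) + Σ {n} (λ i → + toℕ i) ≡⟨ cong₂ _+_ (Σ-one n) (Σ-toℕ≡nC2 n) ⟩
  + (n ℕ.+ n C 2)                          ≡⟨ cong (λ m → + (m ℕ.+ n C 2)) (nC1≡n n) ⟨
  + (n C 1 ℕ.+ n C 2)                      ≡⟨ cong +_ (nCk+nC[k+1]≡[n+1]C[k+1] n 1) ⟩
  + (suc n C 2)                            ∎

0≤i⇒0≤j⇒0≤i*j : ∀ {i j} → 0ℤ ≤ i → 0ℤ ≤ j → 0ℤ ≤ i * j
0≤i⇒0≤j⇒0≤i*j {j = j} 0≤i 0≤j = ℤ.*-monoʳ-≤-nonNeg j {{nonNegative 0≤j}} 0≤i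

if-then-0-+-not : ∀ b (x : ℤ) → (if b then x else 0ℤ) + (if not b then x else 0ℤ) ≡ x
if-then-0-+-not true  x = ℤ.+-identityʳ x
if-then-0-+-not false x = ℤ.+-identityˡ x

*-if-then-0 : ∀ b (x y : ℤ) → x * (if b then y else 0ℤ) ≡ (if b then x * y else 0ℤ)
*-if-then-0 true  x y = refl
*-if-then-0 false x y = ℤ.*-zeroʳ x

if-then-0-* : ∀ b (x y : ℤ) → (if b then x else 0ℤ) * y ≡ (if b then x * y else 0ℤ)
if-then-0-* true  x y = refl
if-then-0-* false x y = ℤ.*-zeroˡ y

<ᵇ-suc : ∀ m n → (m <ᵇ suc n) ≡ (m ≤ᵇ n)
<ᵇ-suc zero    n = refl
<ᵇ-suc (suc m) n = refl

≤ᵇ≡not-<ᵇ : ∀ m n → (m ≤ᵇ n) ≡ not (n <ᵇ m)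
≤ᵇ≡not-<ᵇ zero    n       = refl
≤ᵇ≡not-<ᵇ (suc m) zero    = refl
≤ᵇ≡not-<ᵇ (suc m) (suc n) = trans (<ᵇ-suc m n) (≤ᵇ≡not-<ᵇ m n)

Σ-partition : ∀ {n} (p : Fin n → Bool) (f : Fin n → ℤ) →
              Σ (λ l → if p l then f l else 0ℤ) + Σ (λ l → if not (p l) then f l else 0ℤ) ≡ Σ f
Σ-partition p f =
  trans (sym (Σ-distrib-+ (λ l → if p l then f l else 0ℤ) (λ l → if not (p l) then f l else 0ℤ)))
        (Σ-cong (λ l → if-then-0-+-not (p l) (f l)))

Σ>+Σ≤ : ∀ {n} (j : Fin n) (f : Fin n → ℤ) →
        Σ (λ l → if toℕ j <ᵇ toℕ l then f l else 0ℤ) + Σ≤ j f ≡ Σ f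
Σ>+Σ≤ {n} j f =
  trans (cong (_+_ (Σ (λ l → if toℕ j <ᵇ toℕ l then f l else 0ℤ)))
              (Σ-cong {n} λ l → cong (if_then f l else 0ℤ) (≤ᵇ≡not-<ᵇ (toℕ l) (toℕ j))))
        (Σ-partition (λ l → toℕ j <ᵇ toℕ l) f)

Σ<-cong : ∀ {n} (i : Fin n) {f g : Fin n → ℤ} → (∀ k → f k ≡ g k) → Σ< i f ≡ Σ< i g
Σ<-cong i f≗g = Σ-cong (λ k → cong (if toℕ k <ᵇ toℕ i then_else 0ℤ) (f≗g k))

Σ<-distrib-+ : ∀ {n} (i : Fin n) (f g : Fin n → ℤ) →
               Σ< i f + Σ< i g ≡ Σ< i (λ k → f k + g k)
Σ<-distrib-+ {n} i f g =
  trans (sym (Σ-distrib-+ {n} _ _)) (Σ-cong λ k → if-+ (toℕ k <ᵇ toℕ i) (f k) (g k))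
  where
  if-+ : ∀ b x y → (if b then x else 0ℤ) + (if b then y else 0ℤ) ≡ (if b then x + y else 0ℤ)
  if-+ true  x y = refl
  if-+ false x y = refl

Σ<-one : ∀ {n} (i : Fin n) → Σ< i (λ _ → 1ℤ) ≡ + toℕ i
Σ<-one {suc n} fzero    = cong (_+_ 0ℤ) (Σ-zero n)
Σ<-one {suc n} (fsuc i) = cong (_+_ 1ℤ) (Σ<-one i)

module _ {n : ℕ} (A : Matrix n) where

  -- inv A unfolds to Σ i Σ j A i j * northeast i j.
  northeast northwest : Fin n → Fin n → ℤ
  northeast i j = Σ< i (λ k → Σ (λ l → if toℕ j <ᵇ toℕ l then A k l else 0ℤ))
  northwest i j = Σ< i (λ k → Σ≤ j (A k))

  slack : ℤ
  slack = Σ (λ i → Σ (λ j → (1ℤ - Σ≤ i (λ i' → A i' j)) * Σ≤ j (A i)))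

  northeast+northwest≡index : (∀ i → Σ (A i) ≡ 1ℤ) →
                        ∀ i j → northeast i j + northwest i j ≡ + toℕ i
  northeast+northwest≡index rowSum i j = begin
    northeast i j + northwest i j
      ≡⟨ Σ<-distrib-+ i _ _ ⟩
    Σ< i (λ k → Σ (λ l → if toℕ j <ᵇ toℕ l then A k l else 0ℤ) + Σ≤ j (A k))
      ≡⟨ Σ<-cong i (λ k → trans (Σ>+Σ≤ j (A k)) (rowSum k)) ⟩
    Σ< i (λ _ → 1ℤ)
      ≡⟨ Σ<-one i ⟩
    + toℕ i
      ∎

  Σ-A*index≡nC2 : (∀ i → Σ (A i) ≡ 1ℤ) →
                      Σ (λ i → Σ (λ j → A i j * + toℕ i)) ≡ + (n C 2)
  Σ-A*index≡nC2 rowSum = begin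
    Σ (λ i → Σ (λ j → A i j * + toℕ i))  ≡⟨ Σ-cong {n} (λ i → *-distribʳ-Σ (+ toℕ i) (A i)) ⟨
    Σ (λ i → Σ (A i) * + toℕ i)          ≡⟨ Σ-cong {n} (λ i → cong (_* + toℕ i) (rowSum i)) ⟩
    Σ {n} (λ i → 1ℤ * + toℕ i)           ≡⟨ Σ-cong {n} (λ i → ℤ.*-identityˡ (+ toℕ i)) ⟩
    Σ {n} (λ i → + toℕ i)                ≡⟨ Σ-toℕ≡nC2 n ⟩
    + (n C 2)                            ∎

  1-Σ≤≡Σ> : (∀ j → Σ (λ i → A i j) ≡ 1ℤ) →
            ∀ i j → 1ℤ - Σ≤ i (λ i' → A i' j) ≡ Σ (λ k → if toℕ i <ᵇ toℕ k then A k j else 0ℤ)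
  1-Σ≤≡Σ> colSum i j = begin
    1ℤ - Σ≤ i col
      ≡⟨ cong (_- Σ≤ i col) (trans (sym (colSum j)) (sym (Σ>+Σ≤ i col))) ⟩
    (Σ (λ k → if toℕ i <ᵇ toℕ k then col k else 0ℤ) + Σ≤ i col) - Σ≤ i col
      ≡⟨ //-rightDividesʳ (AbelianGroup.group +-0-abelianGroup) (Σ≤ i col) _ ⟩
    Σ (λ k → if toℕ i <ᵇ toℕ k then col k else 0ℤ)
      ∎
    where
    col : Fin n → ℤ
    col k = A k j

  Σ-A*northwest≡slack : (∀ j → Σ (λ i → A i j) ≡ 1ℤ) →
                            Σ (λ k → Σ (λ j → A k j * northwest k j)) ≡ slack
  Σ-A*northwest≡slack colSum = begin
    Σ (λ k → Σ (λ j → A k j * northwest k j))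
      ≡⟨ Σ-cong {n} (λ k → Σ-cong {n} λ j →
           trans (*-distribˡ-Σ {n} (A k j) _)
                 (Σ-cong {n} λ i → *-if-then-0 (toℕ i <ᵇ toℕ k) (A k j) _)) ⟩
    Σ (λ k → Σ (λ j → Σ (λ i → term i j k)))
      ≡⟨ Σ-comm₃ ⟩
    Σ (λ i → Σ (λ j → Σ (λ k → term i j k)))
      ≡⟨ Σ-cong {n} (λ i → Σ-cong {n} λ j →
           trans (Σ-cong {n} λ k → sym (if-then-0-* (toℕ i <ᵇ toℕ k) (A k j) _))
                 (sym (*-distribʳ-Σ {n} _ _))) ⟩
    Σ (λ i → Σ (λ j → Σ (λ k → if toℕ i <ᵇ toℕ k then A k j else 0ℤ) * Σ≤ j (A i)))
      ≡⟨ Σ-cong {n} (λ i → Σ-cong {n} λ j → cong (_* Σ≤ j (A i)) (sym (1-Σ≤≡Σ> colSum i j))) ⟩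
    slack
      ∎
    where
    term : Fin n → Fin n → Fin n → ℤ
    term i j k = if toℕ i <ᵇ toℕ k then A k j * Σ≤ j (A i) else 0ℤ

    Σ-comm₃ : Σ (λ k → Σ (λ j → Σ (λ i → term i j k))) ≡ Σ (λ i → Σ (λ j → Σ (λ k → term i j k)))
    Σ-comm₃ = trans (Σ-cong {n} λ k → Σ-comm (λ j i → term i j k))
             (trans (Σ-comm (λ k i → Σ (λ j → term i j k)))
                    (Σ-cong {n} λ i → Σ-comm (λ k j → term i j k)))

  binomial≡inv+slack : (∀ i → Σ (A i) ≡ 1ℤ) → (∀ j → Σ (λ i → A i j) ≡ 1ℤ) →
                       + (n C 2) ≡ inv A + slack
  binomial≡inv+slack rowSum colSum = begin
    + (n C 2)
      ≡⟨ Σ-A*index≡nC2 rowSum ⟨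
    Σ (λ i → Σ (λ j → A i j * + toℕ i))
      ≡⟨ Σ-cong {n} (λ i → Σ-cong {n} λ j →
           cong (A i j *_) (sym (northeast+northwest≡index rowSum i j))) ⟩
    Σ (λ i → Σ (λ j → A i j * (northeast i j + northwest i j)))
      ≡⟨ Σ-cong {n} (λ i →
           trans (Σ-cong {n} λ j → ℤ.*-distribˡ-+ (A i j) _ _) (Σ-distrib-+ {n} _ _)) ⟩
    Σ (λ i → Σ (λ j → A i j * northeast i j) + Σ (λ j → A i j * northwest i j))
      ≡⟨ Σ-distrib-+ {n} _ _ ⟩
    inv A + Σ (λ i → Σ (λ j → A i j * northwest i j))
      ≡⟨ cong (_+_ (inv A)) (Σ-A*northwest≡slack colSum) ⟩
    inv A + slack
      ∎

  slack-nonneg : (∀ i j → Σ≤ i (λ i' → A i' j) ≤ 1ℤ) → (∀ i j → 0ℤ ≤ Σ≤ j (A i)) → 0ℤ ≤ slack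
  slack-nonneg colPrefHi rowPref = Σ-nonneg _ λ i → Σ-nonneg _ λ j →
    0≤i⇒0≤j⇒0≤i*j (ℤ.i≤j⇒0≤j-i (colPrefHi i j)) (rowPref i j)

  inv≤binomial : (∀ i → Σ (A i) ≡ 1ℤ) → (∀ j → Σ (λ i → A i j) ≡ 1ℤ) →
                 (∀ i j → Σ≤ i (λ i' → A i' j) ≤ 1ℤ) → (∀ i j → 0ℤ ≤ Σ≤ j (A i)) →
                 inv A ≤ + (n C 2)
  inv≤binomial rowSum colSum colPrefHi rowPref =
    subst (inv A ≤_) (sym (binomial≡inv+slack rowSum colSum))
          (ℤ.i≤i+j (inv A) slack {{nonNegative (slack-nonneg colPrefHi rowPref)}})

corollary3p20 : (n : ℕ) → 1 ≤ℕ n → (A : Matrix n) → IsMagog A →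
                inv A ≤ + (n C 2)
corollary3p20 n _ A magog = inv≤binomial A rowSum colSum colPrefHi rowPref
  where open IsMagog magog
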